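{- Let $G=(A,B,E)$ be a connected bipartite graph with parts $A$ and $B$, and let $\mathcal{F}\subseteq 2^{[n]}$ be such that $Kn_n[\mathcal{F}]$ contains no subgraph isomorphic to $G$. Let $$\mathcal{F}_{sym}:=\mathcal{F}\cap \mathcal{F}^c\cap \bigcup_{ -n^{2/3}\le i\le n^{2/3}}\binom{[n]}{\lfloor n/2\rfloor+i}.$$ Then, if $n$ is large enough (depending on $G$), $\mathcal{F}_{sym}$ is $P_{G,A}$-free.
   Context: The Kneser cube $Kn_n$ is the graph with vertex set $2^{[n]}$ (all subsets of $[n]=\{1,\dots,n\}$) in which two distinct vertices $F,F'$ are adjacent iff $F\cap F'=\emptyset$; $Kn_n[\mathcal{F}]$ is the induced subgraph on $\mathcal{F}$. $\mathcal{F}^c=\{[n]\setminus F: F\in\mathcal{F}\}$ and $\binom{[n]}{m}$ is the family of $m$-element subsets of $[n]$ (the union runs over integers $i$). For a bipartite graph $G=(A,B,E)$, $P_{G,A}$ is the poset on $V(G)$ whose Hasse diagram is $G$ with every edge oriented towards its endpoint in $A$; i.e. the relations are $b\prec a$ for $b\in B$, $a\in A$, $ab\in E$. A family $\mathcal{G}\subseteq 2^{[n]}$ is a copy of a poset $(P,\prec)$ if there is a bijection $\beta:P\to\mathcal{G}$ such that $p\prec q$ implies $\beta(p)\subseteq\beta(q)$; a family is $P$-free if it contains no copy of $P$. -}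

module Defs where

open import Data.Nat using (ℕ; _≤_; _^_; ∣_-_∣; _/_)
open import Data.Fin using (Fin)
open import Data.Fin.Subset using (Subset; _∩_; _⊆_; ∁; ∣_∣; Empty)
open import Data.Sum using (_⊎_; inj₁; inj₂)
open import Data.Product using (_×_)
open import Data.Empty using (⊥)
open import Relation.Binary.Construct.Closure.ReflexiveTransitive using (Star)
open import Function.Definitions using (Injective)
open import Relation.Binary.PropositionalEquality using (_≡_)

-- A bipartite graph G = (A, B, E) with A = Fin a, B = Fin b and
-- edge relation E x y meaning "x ∈ A is adjacent to y ∈ B".
-- Vertex set of G: A ⊎ B.
Vtx : ℕ → ℕ → Set
Vtx a b = Fin a ⊎ Fin b

Adj : ∀ {a b} → (Fin a → Fin b → Set) → Vtx a b → Vtx a b → Set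
Adj E (inj₁ x) (inj₂ y) = E x y
Adj E (inj₂ y) (inj₁ x) = E x y
Adj E (inj₁ _) (inj₁ _) = ⊥
Adj E (inj₂ _) (inj₂ _) = ⊥

Connected : ∀ {a b} → (Fin a → Fin b → Set) → Set
Connected E = ∀ u v → Star (Adj E) u v

Family : ℕ → Set₁
Family n = Subset n → Set

-- Kn_n[F] contains a subgraph isomorphic to G: an injective map of the
-- vertices of G into F sending edges to disjoint pairs (Kneser adjacency;
-- distinctness is guaranteed by injectivity).
KneserContains : ∀ {a b} (E : Fin a → Fin b → Set) {n} → Family n → Set
KneserContains {a} {b} E {n} F =
  Σ' (Vtx a b → Subset n) λ φ →
      Injective _≡_ _≡_ φ
    × (∀ v → F (φ v))
    × (∀ x y → E x y → Empty (φ (inj₁ x) ∩ φ (inj₂ y)))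
  where
  open import Data.Product using () renaming (Σ to Σ')

-- F contains a copy of the poset P_{G,A}: an injective map β of A ⊎ B
-- into F with b ≺ a (i.e. E a b) implying β(b) ⊆ β(a).
ContainsPGA : ∀ {a b} (E : Fin a → Fin b → Set) {n} → Family n → Set
ContainsPGA {a} {b} E {n} F =
  Σ' (Vtx a b → Subset n) λ β →
      Injective _≡_ _≡_ β
    × (∀ v → F (β v))
    × (∀ x y → E x y → β (inj₂ y) ⊆ β (inj₁ x))
  where
  open import Data.Product using () renaming (Σ to Σ')

-- A k-subset is in the middle band ⋃_{-n^{2/3} ≤ i ≤ n^{2/3}} binom([n], ⌊n/2⌋+i):
-- with d = |k - ⌊n/2⌋|, the condition d ≤ n^{2/3} is equivalent to d^3 ≤ n^2.
MiddleBand : ∀ n → Subset n → Set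
MiddleBand n S = ∣ ∣ S ∣ - n / 2 ∣ ^ 3 ≤ n ^ 2

Fsym : ∀ {n} → Family n → Family n
Fsym {n} F S = F S × F (∁ S) × MiddleBand n S

{-# OPTIONS --safe #-}

-- Complementing the sets placed on A turns a copy β of P_{G,A} in F_sym into a
-- copy of G in Kn_n[F]: β(b) ⊆ β(a) becomes β(b) ∩ ([n] ∖ β(a)) = ∅.  The map
-- can only fail to be injective if β(b) = [n] ∖ β(a), i.e. if β(a) and β(b) are
-- at Hamming distance n.  But adjacent vertices carry nested sets of the middle
-- band, at distance at most 2n^{2/3}, and G is connected, so a and b are joined
-- by a walk of length ℓ bounded in terms of G alone; their distance is then at
-- most 2ℓn^{2/3} < n as soon as n > (2ℓ)³.

module Submission where

open import Defs
open import Data.Nat using (ℕ; _≤_)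
open import Data.Fin using (Fin)
open import Data.Product using (∃-syntax)
open import Relation.Nullary using (¬_)

open import Data.Nat using (zero; suc; _+_; _*_; _^_; _<_; ∣_-_∣; _/_; s≤s)
open import Data.Nat.Properties
open import Algebra.Properties.CommutativeSemiring.Exp +-*-commutativeSemiring using (^-distrib-*)
open import Data.Fin using (zero; suc)
open import Data.Fin.Subset using (Subset; inside; outside; _⊆_; _∩_; ∁; ∣_∣; Empty)
open import Data.Fin.Subset.Properties using (drop-∷-⊆; ⊆-reflexive; ⊆-antisym; ∁p⊆∁q⇒p⊇q; x∈∁p⇒x∉p; x∈p∩q⁻)
open import Data.Vec using ([]; _∷_; here)
open import Data.Sum using (inj₁; inj₂)
open import Data.Product using (_,_; proj₁; proj₂)
open import Data.Empty using (⊥-elim)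
open import Function using (_∘_)
open import Function.Definitions using (Injective)
open import Relation.Binary.PropositionalEquality
open import Relation.Binary.Construct.Closure.ReflexiveTransitive using (Star; ε; _◅_; fold)

private
  variable
    n : ℕ
    s t : Subset n

hamming : Subset n → Subset n → ℕ
hamming []            []            = 0
hamming (inside  ∷ s) (inside  ∷ t) = hamming s t
hamming (outside ∷ s) (outside ∷ t) = hamming s t
hamming (inside  ∷ s) (outside ∷ t) = suc (hamming s t)
hamming (outside ∷ s) (inside  ∷ t) = suc (hamming s t)

hamming-self : (s : Subset n) → hamming s s ≡ 0
hamming-self []            = refl
hamming-self (inside  ∷ s) = hamming-self s
hamming-self (outside ∷ s) = hamming-self s

hamming-sym : (s t : Subset n) → hamming s t ≡ hamming t s
hamming-sym []            []            = refl
hamming-sym (inside  ∷ s) (inside  ∷ t) = hamming-sym s t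
hamming-sym (outside ∷ s) (outside ∷ t) = hamming-sym s t
hamming-sym (inside  ∷ s) (outside ∷ t) = cong suc (hamming-sym s t)
hamming-sym (outside ∷ s) (inside  ∷ t) = cong suc (hamming-sym s t)

hamming-∁ : (s : Subset n) → hamming (∁ s) s ≡ n
hamming-∁ []            = refl
hamming-∁ (inside  ∷ s) = cong suc (hamming-∁ s)
hamming-∁ (outside ∷ s) = cong suc (hamming-∁ s)

hamming-triangle : (s t u : Subset n) → hamming s u ≤ hamming s t + hamming t u
hamming-triangle []            []            []            = ≤-refl
hamming-triangle (inside  ∷ s) (inside  ∷ t) (inside  ∷ u) = hamming-triangle s t u
hamming-triangle (outside ∷ s) (outside ∷ t) (outside ∷ u) = hamming-triangle s t u
hamming-triangle (inside  ∷ s) (inside  ∷ t) (outside ∷ u) =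
  ≤-trans (s≤s (hamming-triangle s t u)) (≤-reflexive (sym (+-suc _ _)))
hamming-triangle (outside ∷ s) (outside ∷ t) (inside  ∷ u) =
  ≤-trans (s≤s (hamming-triangle s t u)) (≤-reflexive (sym (+-suc _ _)))
hamming-triangle (inside  ∷ s) (outside ∷ t) (inside  ∷ u) =
  ≤-trans (hamming-triangle s t u) (+-mono-≤ (n≤1+n _) (n≤1+n _))
hamming-triangle (outside ∷ s) (inside  ∷ t) (outside ∷ u) =
  ≤-trans (hamming-triangle s t u) (+-mono-≤ (n≤1+n _) (n≤1+n _))
hamming-triangle (inside  ∷ s) (outside ∷ t) (outside ∷ u) = s≤s (hamming-triangle s t u)
hamming-triangle (outside ∷ s) (inside  ∷ t) (inside  ∷ u) = s≤s (hamming-triangle s t u)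

hamming-⊆ : t ⊆ s → ∣ t ∣ + hamming s t ≡ ∣ s ∣
hamming-⊆ {t = []}          {[]}          t⊆s = refl
hamming-⊆ {t = inside  ∷ t} {inside  ∷ s} t⊆s = cong suc (hamming-⊆ (drop-∷-⊆ t⊆s))
hamming-⊆ {t = outside ∷ t} {outside ∷ s} t⊆s = hamming-⊆ (drop-∷-⊆ t⊆s)
hamming-⊆ {t = outside ∷ t} {inside  ∷ s} t⊆s =
  trans (+-suc ∣ t ∣ _) (cong suc (hamming-⊆ (drop-∷-⊆ t⊆s)))
hamming-⊆ {t = inside  ∷ t} {outside ∷ s} t⊆s with () ← t⊆s here

∁-injective : ∁ s ≡ ∁ t → s ≡ t
∁-injective ∁s≡∁t = ⊆-antisym (∁p⊆∁q⇒p⊇q (⊆-reflexive (sym ∁s≡∁t))) (∁p⊆∁q⇒p⊇q (⊆-reflexive ∁s≡∁t))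

deviation : Subset n → ℕ
deviation {n} s = ∣ ∣ s ∣ - n / 2 ∣

hamming-⊆-≤-deviation : t ⊆ s → hamming s t ≤ deviation t + deviation s
hamming-⊆-≤-deviation {n} {t} {s} t⊆s = begin
  hamming s t                              ≡⟨ ∣m-m+n∣≡n (∣ t ∣) (hamming s t) ⟨
  ∣ (∣ t ∣) - (∣ t ∣ + hamming s t) ∣      ≡⟨ cong (λ k → ∣ (∣ t ∣) - k ∣) (hamming-⊆ t⊆s) ⟩
  ∣ (∣ t ∣) - (∣ s ∣) ∣                    ≤⟨ ∣-∣-triangle (∣ t ∣) (n / 2) (∣ s ∣) ⟩
  deviation t + ∣ n / 2 - (∣ s ∣) ∣        ≡⟨ cong (deviation t +_) (∣-∣-comm (n / 2) (∣ s ∣)) ⟩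
  deviation t + deviation s                ∎
  where open ≤-Reasoning

d³≤n²∧m³<n⇒m*d<n : ∀ m d n → d ^ 3 ≤ n ^ 2 → m ^ 3 < n → m * d < n
d³≤n²∧m³<n⇒m*d<n m d n@(suc _) d³≤n² m³<n = ≰⇒> λ n≤m*d →
  <⇒≱ m³<n (*-cancelʳ-≤ n (m ^ 3) (n ^ 2) {{m^n≢0 n 2}} (begin
    n * n ^ 2      ≤⟨ ^-monoˡ-≤ 3 n≤m*d ⟩
    (m * d) ^ 3    ≡⟨ ^-distrib-* m d 3 ⟩
    m ^ 3 * d ^ 3  ≤⟨ *-monoʳ-≤ (m ^ 3) d³≤n² ⟩
    m ^ 3 * n ^ 2  ∎))
  where open ≤-Reasoning

2*m<n∧2*k<n⇒m+k<n : ∀ m k n → 2 * m < n → 2 * k < n → m + k < n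
2*m<n∧2*k<n⇒m+k<n m k n 2m<n 2k<n with ≤-total m k
... | inj₁ m≤k = ≤-<-trans (+-monoˡ-≤ k m≤k) (subst (_< n) (cong (k +_) (+-identityʳ k)) 2k<n)
... | inj₂ k≤m = ≤-<-trans (+-monoʳ-≤ m k≤m) (subst (_< n) (cong (m +_) (+-identityʳ m)) 2m<n)

-- ℕ has no n^{2/3}: the bound 2ℓ·n^{2/3} < n is stated as (2ℓ)³ < n, which
-- forces every distance to be multiplied by ℓ.
scaled-hamming-⊆-middle : ∀ ℓ → (2 * ℓ) ^ 3 < n → MiddleBand n s → MiddleBand n t → t ⊆ s →
                          ℓ * hamming s t < n
scaled-hamming-⊆-middle {n} {s} {t} ℓ short s-middle t-middle t⊆s = begin-strict
  ℓ * hamming s t                        ≤⟨ *-monoʳ-≤ ℓ (hamming-⊆-≤-deviation t⊆s) ⟩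
  ℓ * (deviation t + deviation s)        ≡⟨ *-distribˡ-+ ℓ (deviation t) (deviation s) ⟩
  ℓ * deviation t + ℓ * deviation s      <⟨ 2*m<n∧2*k<n⇒m+k<n (ℓ * deviation t) (ℓ * deviation s) n
                                              (twice< t t-middle) (twice< s s-middle) ⟩
  n                                      ∎
  where
  open ≤-Reasoning
  twice< : ∀ u → MiddleBand n u → 2 * (ℓ * deviation u) < n
  twice< u u-middle =
    subst (_< n) (*-assoc 2 ℓ (deviation u)) (d³≤n²∧m³<n⇒m*d<n (2 * ℓ) (deviation u) n u-middle short)

module _ {A : Set} {R : A → A → Set} where

  length : ∀ {u v} → Star R u v → ℕ
  length = fold (λ _ _ → ℕ) (λ _ → suc) 0

  module _ (d : A → A → ℕ) (d-self : ∀ u → d u u ≡ 0)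
           (d-triangle : ∀ u t v → d u v ≤ d u t + d t v) {c : ℕ} where

    walk-≤ : (∀ {x y} → R x y → d x y ≤ c) → ∀ {u v} (w : Star R u v) → d u v ≤ length w * c
    walk-≤ step {u} ε        = ≤-reflexive (d-self u)
    walk-≤ step {u} {v} (_◅_ {j = t} e w) =
      ≤-trans (d-triangle u t v) (+-mono-≤ (step e) (walk-≤ step w))

    walk-< : (∀ {x y} → R x y → d x y < c) →
             ∀ {u t v} (e : R u t) (w : Star R t v) → d u v < length (e ◅ w) * c
    walk-< step {u} {t} {v} e w =
      ≤-<-trans (d-triangle u t v) (+-mono-<-≤ (step e) (walk-≤ (<⇒≤ ∘ step) w))

module PGACopy {a b} {E : Fin a → Fin b → Set} {n}
               (β : Vtx a b → Subset n) (β-⊆ : ∀ x y → E x y → β (inj₂ y) ⊆ β (inj₁ x)) where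

  complementA : Vtx a b → Subset n
  complementA (inj₁ x) = ∁ (β (inj₁ x))
  complementA (inj₂ y) = β (inj₂ y)

  complementA-disjoint : ∀ x y → E x y → Empty (complementA (inj₁ x) ∩ complementA (inj₂ y))
  complementA-disjoint x y e (i , i∈∩) with x∈p∩q⁻ (complementA (inj₁ x)) (complementA (inj₂ y)) i∈∩
  ... | i∈∁βx , i∈βy = x∈∁p⇒x∉p i∈∁βx (β-⊆ x y e i∈βy)

  module _ (β-middle : ∀ v → MiddleBand n (β v)) where

    edge-scaled-hamming : ∀ ℓ → (2 * ℓ) ^ 3 < n → ∀ {u v} → Adj E u v → ℓ * hamming (β u) (β v) < n
    edge-scaled-hamming ℓ short {inj₁ x} {inj₂ y} e =
      scaled-hamming-⊆-middle ℓ short (β-middle _) (β-middle _) (β-⊆ x y e)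
    edge-scaled-hamming ℓ short {inj₂ y} {inj₁ x} e
      rewrite hamming-sym (β (inj₂ y)) (β (inj₁ x)) =
      scaled-hamming-⊆-middle ℓ short (β-middle _) (β-middle _) (β-⊆ x y e)

    short-walk-∁⇒≡ : ∀ {u v} (w : Star (Adj E) u v) → (2 * length w) ^ 3 < n →
                     β u ≡ ∁ (β v) → u ≡ v
    short-walk-∁⇒≡ ε _ _ = refl
    short-walk-∁⇒≡ {u} {v} w@(e ◅ w′) short βu≡∁βv = ⊥-elim (<-irrefl refl (begin-strict
      ℓ * n                      ≡⟨ cong (ℓ *_) (trans (cong (λ z → hamming z (β v)) βu≡∁βv) (hamming-∁ (β v))) ⟨
      ℓ * hamming (β u) (β v)    <⟨ walk-< d d-self d-triangle (edge-scaled-hamming ℓ short) e w′ ⟩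
      ℓ * n                      ∎))
      where
      open ≤-Reasoning
      ℓ : ℕ
      ℓ = length w
      d : Vtx a b → Vtx a b → ℕ
      d u v = ℓ * hamming (β u) (β v)
      d-self : ∀ u → d u u ≡ 0
      d-self u = trans (cong (ℓ *_) (hamming-self (β u))) (*-zeroʳ ℓ)
      d-triangle : ∀ u t v → d u v ≤ d u t + d t v
      d-triangle u t v = ≤-trans (*-monoʳ-≤ ℓ (hamming-triangle (β u) (β t) (β v)))
                                 (≤-reflexive (*-distribˡ-+ ℓ (hamming (β u) (β t)) _))

    complementA-injective : Injective _≡_ _≡_ β →
                            (walk : ∀ x y → Star (Adj E) (inj₂ y) (inj₁ x)) →
                            (∀ x y → (2 * length (walk x y)) ^ 3 < n) →
                            Injective _≡_ _≡_ complementA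
    complementA-injective β-inj walk short {inj₁ x} {inj₁ x′} eq =
      β-inj (∁-injective eq)
    complementA-injective β-inj walk short {inj₂ y} {inj₂ y′} eq = β-inj eq
    complementA-injective β-inj walk short {inj₁ x} {inj₂ y} eq
      with () ← short-walk-∁⇒≡ (walk x y) (short x y) (sym eq)
    complementA-injective β-inj walk short {inj₂ y} {inj₁ x} eq
      with () ← short-walk-∁⇒≡ (walk x y) (short x y) eq

pga-copy⇒kneser-copy : ∀ {a b} {E : Fin a → Fin b → Set} {n}
                       (walk : ∀ x y → Star (Adj E) (inj₂ y) (inj₁ x)) →
                       (∀ x y → (2 * length (walk x y)) ^ 3 < n) →
                       (F : Family n) → ContainsPGA E (Fsym F) → KneserContains E F
pga-copy⇒kneser-copy walk short F (β , β-inj , β∈Fsym , β-⊆) =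
  complementA , complementA-injective β-middle β-inj walk short , complementA∈F , complementA-disjoint
  where
  open PGACopy β β-⊆
  β-middle : ∀ v → MiddleBand _ (β v)
  β-middle v = proj₂ (proj₂ (β∈Fsym v))
  complementA∈F : ∀ v → F (complementA v)
  complementA∈F (inj₁ x) = proj₁ (proj₂ (β∈Fsym (inj₁ x)))
  complementA∈F (inj₂ y) = proj₁ (β∈Fsym (inj₂ y))

bounded : ∀ {k} (f : Fin k → ℕ) → ∃[ M ] (∀ i → f i ≤ M)
bounded {zero}  f = 0 , λ ()
bounded {suc k} f with bounded (f ∘ suc)
... | M , f∘suc≤M = f zero + M , λ where
  zero    → m≤m+n (f zero) M
  (suc i) → m≤n⇒m≤o+n (f zero) (f∘suc≤M i)

bounded² : ∀ {k l} (f : Fin k → Fin l → ℕ) → ∃[ M ] (∀ i j → f i j ≤ M)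
bounded² f with bounded (λ i → proj₁ (bounded (f i)))
... | M , rows≤M = M , λ i j → ≤-trans (proj₂ (bounded (f i)) j) (rows≤M i)

lemma6 : (a b : ℕ) (E : Fin a → Fin b → Set) → Connected E →
    ∃[ N ] ∀ n → N ≤ n → (F : Family n) →
      ¬ KneserContains E F → ¬ ContainsPGA E (Fsym F)
lemma6 a b E connected =
  suc ((2 * K) ^ 3) , λ n N≤n F no-kneser-copy →
    no-kneser-copy ∘ pga-copy⇒kneser-copy walk (λ x y → ≤-trans (s≤s (short x y)) N≤n) F
  where
  walk : ∀ x y → Star (Adj E) (inj₂ y) (inj₁ x)
  walk x y = connected (inj₂ y) (inj₁ x)
  lengths-bounded : ∃[ K ] (∀ x y → length (walk x y) ≤ K)
  lengths-bounded = bounded² (λ x y → length (walk x y))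
  K : ℕ
  K = proj₁ lengths-bounded
  short : ∀ x y → (2 * length (walk x y)) ^ 3 ≤ (2 * K) ^ 3
  short x y = ^-monoˡ-≤ 3 (*-monoʳ-≤ 2 (proj₂ lengths-bounded x y))
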